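{- Let $c>0$ be fixed, $p=c/n$, $q=1-p$, and $P=P_{\mathcal{G}(n,p)}$. Let $U,V$ be a partition of $[n]$ such that $x<y$ (natural order) for all $x\in V$, $y\in U$. Then for every integer $s\ge1$, \[ \mathbb{P}\big(|U_P[V]\cap U|=s\big)=q^{|V|(|U|-s)}\prod_{j=0}^{s-1}\big(1-q^{j+|V|}\big)\prod_{i=1}^{s}\frac{1-q^{|U|-s+i}}{1-q^i}. \]
   Context: $\mathcal{G}(n,p)$ is the Erdős–Rényi random graph on $[n]$. $P_{\mathcal{G}(n,p)}$ is the poset on $[n]$ with $i<_Pj$ iff there are $i=u_1<\dots<u_k=j$ (natural order) forming a path $u_1\cdots u_k$ in $\mathcal{G}(n,p)$. $U_P[V]=\{x: y\le_P x\text{ for some }y\in V\}$. -}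

module Defs where

open import Data.Bool using (Bool; true; false; if_then_else_; _∧_)
open import Data.Nat as ℕ using (ℕ; zero; suc)
open import Data.Integer as ℤ using (ℤ; +_; -[1+_])
open import Data.Rational using (ℚ; 0ℚ; 1ℚ; _+_; _*_; _-_; _÷_; ≢-nonZero)
open import Data.Rational.Properties using (_≟_)
open import Data.Fin using (Fin; toℕ; _<_)
open import Data.Fin.Properties using () renaming (_≟_ to _≟ᶠ_)
open import Data.Fin.Subset using (Subset; _∈_)
open import Data.Fin.Subset.Properties using (_∈?_)
open import Data.List using (List; []; _∷_; filter; concatMap; map; length)
open import Data.List.Base using () renaming (allFin to allFinL)
open import Data.Product using (_×_; _,_; ∃-syntax)
open import Data.Sum using (_⊎_)
open import Relation.Binary.PropositionalEquality using (_≡_)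
open import Relation.Nullary using (Dec; yes; no; ¬_)
open import Relation.Nullary.Decidable using (⌊_⌋)

_^_ : ℚ → ℕ → ℚ
x ^ zero = 1ℚ
x ^ suc k = x * (x ^ k)

-- total division on ℚ (x / 0 := 0); only used where the denominator is nonzero
-- or in degenerate cases where the paper's formula is itself undefined
_⊘_ : ℚ → ℚ → ℚ
x ⊘ y with y ≟ 0ℚ
... | yes _ = 0ℚ
... | no y≢0 = _÷_ x y {{≢-nonZero y≢0}}

_^ℤ_ : ℚ → ℤ → ℚ
x ^ℤ (+ k) = x ^ k
x ^ℤ (-[1+ k ]) = 1ℚ ⊘ (x ^ suc k)

-- ∏_{i = a}^{b} f i  (empty product = 1 when b < a); here prodFrom a k f = ∏_{i=a}^{a+k-1} f i
prodFrom : ℕ → ℕ → (ℕ → ℚ) → ℚ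
prodFrom a zero f = 1ℚ
prodFrom a (suc k) f = f a * prodFrom (suc a) k f

-- A graph on vertex set Fin n (= [n], relabelled 0..n-1, natural order preserved):
-- G i j = true means ij is an edge; only entries with i < j are ever consulted.
Graph : ℕ → Set
Graph n = Fin n → Fin n → Bool

emptyGraph : ∀ {n} → Graph n
emptyGraph _ _ = false

setEdge : ∀ {n} → Fin n → Fin n → Bool → Graph n → Graph n
setEdge i j b G i' j' with i ≟ᶠ i' | j ≟ᶠ j'
... | yes _ | yes _ = b
... | _ | _ = G i' j'

pairs : (n : ℕ) → List (Fin n × Fin n)
pairs n = concatMap (λ i → map (λ j → (i , j)) (filter (λ j → Data.Fin._<?_ i j) (allFinL n))) (allFinL n)
  where import Data.Fin

-- Expectation of f over the random graph in which each pair of the list is an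
-- edge independently with probability p (pairs not in the list are non-edges).
expectOver : ∀ {n} → ℚ → List (Fin n × Fin n) → (Graph n → ℚ) → ℚ
expectOver p [] f = f emptyGraph
expectOver p ((i , j) ∷ es) f =
  p * expectOver p es (λ G → f (setEdge i j true G))
  + (1ℚ - p) * expectOver p es (λ G → f (setEdge i j false G))

𝔼 : (n : ℕ) → ℚ → (Graph n → ℚ) → ℚ
𝔼 n p f = expectOver p (pairs n) f

𝟙 : Bool → ℚ
𝟙 true = 1ℚ
𝟙 false = 0ℚ

ℙ : (n : ℕ) → ℚ → (Graph n → Bool) → ℚ
ℙ n p E = 𝔼 n p (λ G → 𝟙 (E G))

data IncPath {n : ℕ} (G : Graph n) : Fin n → Fin n → Set where
  edge : ∀ {i j} → i < j → G i j ≡ true → IncPath G i j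
  step : ∀ {i k j} → i < k → G i k ≡ true → IncPath G k j → IncPath G i j

-- the poset P_G : i <_P j iff IncPath G i j
_<[_]_ : ∀ {n} → Fin n → Graph n → Fin n → Set
i <[ G ] j = IncPath G i j

_≤[_]_ : ∀ {n} → Fin n → Graph n → Fin n → Set
i ≤[ G ] j = (i ≡ j) ⊎ IncPath G i j

_∈Up[_,_] : ∀ {n} → Fin n → Graph n → Subset n → Set
x ∈Up[ G , V ] = ∃[ y ] (y ∈ V × y ≤[ G ] x)

-- |U_P[V] ∩ U|, computed from a decision procedure for membership in U_P[V]
-- (any two decision procedures give the same value)
countUpIn : ∀ {n} (G : Graph n) (V U : Subset n) →
            ((x : Fin n) → Dec (x ∈Up[ G , V ])) → ℕ
countUpIn {n} G V U d = length (filter (λ x → x ∈? U) (filter d (allFinL n)))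

pOf : ℚ → (n : ℕ) → .{{_ : ℕ.NonZero n}} → ℚ
pOf c n = c * ((+ 1) Data.Rational./ n)
  where import Data.Rational

qOf : ℚ → (n : ℕ) → .{{_ : ℕ.NonZero n}} → ℚ
qOf c n = 1ℚ - pOf c n

{-# OPTIONS --safe #-}
-- Expose the vertices in increasing order. As the order of P is generated by increasing paths, a
-- vertex lies in U_P[V] iff it is in V or adjacent to an earlier vertex of U_P[V]. Hence, after
-- the first k vertices have been exposed, each later vertex is still missed independently, with
-- probability q^r where r is the number of vertices reached so far. The vertices of V come first
-- and are all reached; afterwards a vertex of U is reached with probability 1 - q^(|V| + j) when
-- j vertices of U were reached before it. The law of |U_P[V] ∩ U| thus satisfies a q-Pascal
-- recursion, whose solution q^(|V|(|U| - s)) (q^|V|; q)_s [|U| choose s]_q is the stated product.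
module Submission where

open import Defs

open import Level using (0ℓ)
open import Function using (_∘_; id)
open import Function.Bundles using (Equivalence; _⇔_; mk⇔)
open import Data.Bool using (Bool; true; false; _∧_; _∨_; not; T)
open import Data.Bool.Properties using (∨-identityʳ; ∨-assoc; T-∨; T-∧; T-≡)
open import Data.Nat as ℕ using (ℕ; NonZero; zero; suc; _≤_; _∸_; _<ᵇ_; z≤n; s≤s)
open import Data.Nat.Properties
  using (suc-injective; +-suc; +-identityʳ; *-suc; m+[n∸m]≡n; m≤n⇒m≤1+n; m≤n⇒m<n∨m≡n)
import Data.Nat.Properties as ℕₚ
open import Data.Integer as ℤ using (+_)
import Data.Integer.Properties as ℤₚ
open import Data.Rational
  using (ℚ; 0ℚ; 1ℚ; _+_; _-_; -_; _*_; 1/_; _<_; Positive; positive; nonNegative; ≢-nonZero)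
  renaming (_≤_ to _≤ℚ_)
open import Data.Rational.Properties
  using (+-*-commutativeRing; *-identityˡ; *-identityʳ; *-assoc; *-zeroˡ; *-zeroʳ; *-distribʳ-+; *-inverseˡ)
  renaming (_≟_ to _≟ℚ_)
import Data.Rational.Properties as ℚₚ
open import Data.Rational.Unnormalised using (mkℚᵘ)
import Data.Rational.Unnormalised.Properties as ℚᵘₚ
open import Data.Fin using (Fin; toℕ; _<?_; _≟_) renaming (zero to fz; suc to fs; _<_ to _<ᶠ_)
open import Data.Fin.Properties using (0≢1+n) renaming (suc-injective to fs-injective)
open import Data.Fin.Subset using (Subset; _∈_; ∣_∣; inside; outside; Empty; ∁)
open import Data.Fin.Subset.Properties
  using (_∈?_; drop-there; Empty-unique; ∣⊥∣≡0; ∣∁p∣≡n∸∣p∣; ∣p∣≤n; x∈∁p⇒x∉p; x∉p⇒x∈∁p; ⊆-antisym)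
open import Data.List using (List; []; _∷_; _++_; length; drop; replicate; map; filter; concat; tabulate)
open import Data.List.Properties
  using (map-∘; map-tabulate; tabulate-cong; concat-map; length-tabulate; drop-[])
open import Data.Vec using (_∷_; here; there)
open import Data.Product using (_×_; _,_)
open import Data.Sum using (_⊎_; inj₁; inj₂; [_,_])
open import Data.Empty using (⊥; ⊥-elim)
open import Relation.Binary.PropositionalEquality
  using (_≡_; refl; sym; trans; cong; cong₂; subst; _≗_; _≢_; module ≡-Reasoning)
open import Relation.Nullary using (Dec; ¬_; yes; no; does; proof)
open import Relation.Nullary.Decidable using (⌊_⌋; dec⇒maybe; isYes≗does; does-⇔; map′; ¬?)
open import Relation.Nullary.Reflects using (det; fromEquivalence)
open import Relation.Unary using (Pred; Decidable)
open import Tactic.RingSolver using (solve-∀)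
open import Tactic.RingSolver.Core.AlmostCommutativeRing using (AlmostCommutativeRing; fromCommutativeRing)

ℚ-ring : AlmostCommutativeRing 0ℓ 0ℓ
ℚ-ring = fromCommutativeRing +-*-commutativeRing (λ x → dec⇒maybe (0ℚ ≟ℚ x))

mix : ℚ → ℚ → ℚ → ℚ
mix t x y = t * x + (1ℚ - t) * y

mix-const : ∀ t x → mix t x x ≡ x
mix-const = identity
  where
  identity : ∀ t x → t * x + (1ℚ - t) * x ≡ x
  identity = solve-∀ ℚ-ring

mix-linear : ∀ t a b x₁ x₂ y₁ y₂ →
  mix t (a * x₁ + b * y₁) (a * x₂ + b * y₂) ≡ a * mix t x₁ x₂ + b * mix t y₁ y₂
mix-linear = identity
  where
  identity : ∀ t a b x₁ x₂ y₁ y₂ →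
    t * (a * x₁ + b * y₁) + (1ℚ - t) * (a * x₂ + b * y₂)
      ≡ a * (t * x₁ + (1ℚ - t) * x₂) + b * (t * y₁ + (1ℚ - t) * y₂)
  identity = solve-∀ ℚ-ring

mix-zero : ∀ x y → mix 0ℚ x y ≡ y
mix-zero = identity
  where
  identity : ∀ x y → 0ℚ * x + (1ℚ - 0ℚ) * y ≡ y
  identity = solve-∀ ℚ-ring

-- Nesting two independent coins is one coin that shows true unless both show false.
mix-or : ∀ t₁ t₂ x y →
  mix t₁ (mix t₂ x x) (mix t₂ x y) ≡ mix (1ℚ - (1ℚ - t₁) * (1ℚ - t₂)) x y
mix-or = identity
  where
  identity : ∀ t₁ t₂ x y →
    t₁ * (t₂ * x + (1ℚ - t₂) * x) + (1ℚ - t₁) * (t₂ * x + (1ℚ - t₂) * y)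
      ≡ (1ℚ - (1ℚ - t₁) * (1ℚ - t₂)) * x + (1ℚ - (1ℚ - (1ℚ - t₁) * (1ℚ - t₂))) * y
  identity = solve-∀ ℚ-ring

^-+ : ∀ q a b → q ^ (a ℕ.+ b) ≡ q ^ a * q ^ b
^-+ q zero    b = sym (*-identityˡ (q ^ b))
^-+ q (suc a) b = trans (cong (q *_) (^-+ q a b)) (sym (*-assoc q (q ^ a) (q ^ b)))

⊘-cancelʳ : ∀ x y → y ≢ 0ℚ → x ⊘ y * y ≡ x
⊘-cancelʳ x y y≢0 with y ≟ℚ 0ℚ
... | yes y≡0 = ⊥-elim (y≢0 y≡0)
... | no  y≢0′ = trans (*-assoc x _ y)
  (trans (cong (x *_) (*-inverseˡ y {{≢-nonZero y≢0′}})) (*-identityʳ x))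

⊘-zeroˡ : ∀ y → 0ℚ ⊘ y ≡ 0ℚ
⊘-zeroˡ y with y ≟ℚ 0ℚ
... | yes _    = refl
... | no  y≢0 = *-zeroˡ ((1/ y) {{≢-nonZero y≢0}})

*-cancelʳ-pos : ∀ {x y} d → .{{Positive d}} → x * d ≡ y * d → x ≡ y
*-cancelʳ-pos d xd≡yd =
  ℚₚ.≤-antisym (ℚₚ.*-cancelʳ-≤-pos d (ℚₚ.≤-reflexive xd≡yd))
               (ℚₚ.*-cancelʳ-≤-pos d (ℚₚ.≤-reflexive (sym xd≡yd)))

-- Independent bits

-- Bit lists are read with a default of false beyond their end.
bit : List Bool → ℕ → Bool
bit []      _       = false
bit (x ∷ b) zero    = x
bit (x ∷ b) (suc i) = bit b i

zipOr : List Bool → List Bool → List Bool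
zipOr []      b       = b
zipOr (x ∷ a) []      = x ∷ a
zipOr (x ∷ a) (y ∷ b) = (x ∨ y) ∷ zipOr a b

bit-zipOr : ∀ a b i → bit (zipOr a b) i ≡ bit a i ∨ bit b i
bit-zipOr []      b       i       = refl
bit-zipOr (x ∷ a) []      i       = sym (∨-identityʳ _)
bit-zipOr (x ∷ a) (y ∷ b) zero    = refl
bit-zipOr (x ∷ a) (y ∷ b) (suc i) = bit-zipOr a b i

bit-zipOr-assoc : ∀ h w z i → bit (zipOr (zipOr h w) z) i ≡ bit (zipOr h (zipOr w z)) i
bit-zipOr-assoc h w z i = begin
    bit (zipOr (zipOr h w) z) i      ≡⟨ bit-zipOr (zipOr h w) z i ⟩
    bit (zipOr h w) i ∨ bit z i      ≡⟨ cong (_∨ bit z i) (bit-zipOr h w i) ⟩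
    (bit h i ∨ bit w i) ∨ bit z i    ≡⟨ ∨-assoc (bit h i) (bit w i) (bit z i) ⟩
    bit h i ∨ (bit w i ∨ bit z i)    ≡⟨ cong (bit h i ∨_) (sym (bit-zipOr w z i)) ⟩
    bit h i ∨ bit (zipOr w z) i      ≡⟨ sym (bit-zipOr h (zipOr w z) i) ⟩
    bit (zipOr h (zipOr w z)) i      ∎
  where open ≡-Reasoning

bit-replicate-false : ∀ k i → bit (replicate k false) i ≡ false
bit-replicate-false zero    i       = refl
bit-replicate-false (suc k) zero    = refl
bit-replicate-false (suc k) (suc i) = bit-replicate-false k i

bit-drop : ∀ a b i → bit (drop a b) i ≡ bit b (a ℕ.+ i)
bit-drop zero    b       i = refl
bit-drop (suc a) []      i = refl
bit-drop (suc a) (x ∷ b) i = bit-drop a b i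

𝔼bits : ℚ → ℕ → (List Bool → ℚ) → ℚ
𝔼bits t zero    g = g []
𝔼bits t (suc k) g = mix t (𝔼bits t k (g ∘ (true ∷_))) (𝔼bits t k (g ∘ (false ∷_)))

𝔼bits-cong : ∀ t k {f g : List Bool → ℚ} → (∀ b → f b ≡ g b) → 𝔼bits t k f ≡ 𝔼bits t k g
𝔼bits-cong t zero    f≗g = f≗g []
𝔼bits-cong t (suc k) f≗g =
  cong₂ (mix t) (𝔼bits-cong t k (f≗g ∘ (true ∷_))) (𝔼bits-cong t k (f≗g ∘ (false ∷_)))

𝔼bits-const : ∀ t k c → 𝔼bits t k (λ _ → c) ≡ c
𝔼bits-const t zero    c = refl
𝔼bits-const t (suc k) c = trans (cong₂ (mix t) (𝔼bits-const t k c) (𝔼bits-const t k c)) (mix-const t c)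

𝔼bits-linear : ∀ t k a b (f g : List Bool → ℚ) →
  𝔼bits t k (λ x → a * f x + b * g x) ≡ a * 𝔼bits t k f + b * 𝔼bits t k g
𝔼bits-linear t zero    a b f g = refl
𝔼bits-linear t (suc k) a b f g =
  trans (cong₂ (mix t) (𝔼bits-linear t k a b _ _) (𝔼bits-linear t k a b _ _)) (mix-linear t a b _ _ _ _)

𝔼bits-drop : ∀ t a k (g : List Bool → ℚ) → 𝔼bits t (a ℕ.+ k) (g ∘ drop a) ≡ 𝔼bits t k g
𝔼bits-drop t zero    k g = refl
𝔼bits-drop t (suc a) k g =
  trans (cong₂ (mix t) (𝔼bits-drop t a k g) (𝔼bits-drop t a k g)) (mix-const t _)

𝔼bits-zero : ∀ k (g : List Bool → ℚ) → 𝔼bits 0ℚ k g ≡ g (replicate k false)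
𝔼bits-zero zero    g = refl
𝔼bits-zero (suc k) g =
  trans (cong₂ (mix 0ℚ) (𝔼bits-zero k _) (𝔼bits-zero k _)) (mix-zero (g (true ∷ replicate k false)) _)

𝔼bits-zipOr : ∀ t₁ t₂ k (g : List Bool → ℚ) →
  𝔼bits t₁ k (λ w → 𝔼bits t₂ k (λ z → g (zipOr w z))) ≡ 𝔼bits (1ℚ - (1ℚ - t₁) * (1ℚ - t₂)) k g
𝔼bits-zipOr t₁ t₂ zero    g = refl
𝔼bits-zipOr t₁ t₂ (suc k) g = begin
    mix t₁ (𝔼bits t₁ k (λ w → mix t₂ (G true w) (G true w)))
           (𝔼bits t₁ k (λ w → mix t₂ (G true w) (G false w)))
  ≡⟨ cong₂ (mix t₁) (𝔼bits-linear t₁ k t₂ (1ℚ - t₂) _ _) (𝔼bits-linear t₁ k t₂ (1ℚ - t₂) _ _) ⟩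
    mix t₁ (mix t₂ (𝔼bits t₁ k (G true)) (𝔼bits t₁ k (G true)))
           (mix t₂ (𝔼bits t₁ k (G true)) (𝔼bits t₁ k (G false)))
  ≡⟨ cong₂ (λ x y → mix t₁ (mix t₂ x x) (mix t₂ x y))
           (𝔼bits-zipOr t₁ t₂ k (g ∘ (true ∷_))) (𝔼bits-zipOr t₁ t₂ k (g ∘ (false ∷_))) ⟩
    mix t₁ (mix t₂ (𝔼bits t k (g ∘ (true ∷_))) (𝔼bits t k (g ∘ (true ∷_))))
           (mix t₂ (𝔼bits t k (g ∘ (true ∷_))) (𝔼bits t k (g ∘ (false ∷_))))
  ≡⟨ mix-or t₁ t₂ _ _ ⟩
    𝔼bits t (suc k) g ∎
  where
  open ≡-Reasoning
  t = 1ℚ - (1ℚ - t₁) * (1ℚ - t₂)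
  G : Bool → List Bool → ℚ
  G x w = 𝔼bits t₂ k (λ z → g (x ∷ zipOr w z))

-- The random graph, one vertex at a time

Edge : ℕ → Set
Edge n = Fin n × Fin n

expectFrom : ∀ {n} → ℚ → List (Edge n) → Graph n → (Graph n → ℚ) → ℚ
expectFrom p []             B f = f B
expectFrom p ((i , j) ∷ es) B f =
  mix p (expectFrom p es B (f ∘ setEdge i j true)) (expectFrom p es B (f ∘ setEdge i j false))

expectOver≡expectFrom : ∀ {n} p (es : List (Edge n)) f → expectOver p es f ≡ expectFrom p es emptyGraph f
expectOver≡expectFrom p []             f = refl
expectOver≡expectFrom p ((i , j) ∷ es) f =
  cong₂ (mix p) (expectOver≡expectFrom p es _) (expectOver≡expectFrom p es _)

expectOver-cong : ∀ {n} p (es : List (Edge n)) {f g : Graph n → ℚ} → (∀ G → f G ≡ g G) →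
  expectOver p es f ≡ expectOver p es g
expectOver-cong p []             f≗g = f≗g emptyGraph
expectOver-cong p ((i , j) ∷ es) f≗g =
  cong₂ (mix p) (expectOver-cong p es (f≗g ∘ setEdge i j true))
                (expectOver-cong p es (f≗g ∘ setEdge i j false))

expectOver-const : ∀ {n} p (es : List (Edge n)) c → expectOver p es (λ _ → c) ≡ c
expectOver-const p []             c = refl
expectOver-const p ((i , j) ∷ es) c =
  trans (cong₂ (mix p) (expectOver-const p es c) (expectOver-const p es c)) (mix-const p c)

expectFrom-linear : ∀ {n} p (es : List (Edge n)) B a b (f g : Graph n → ℚ) →
  expectFrom p es B (λ G → a * f G + b * g G) ≡ a * expectFrom p es B f + b * expectFrom p es B g
expectFrom-linear p []             B a b f g = refl
expectFrom-linear p ((i , j) ∷ es) B a b f g =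
  trans (cong₂ (mix p) (expectFrom-linear p es B a b _ _) (expectFrom-linear p es B a b _ _))
        (mix-linear p a b _ _ _ _)

expectFrom-++ : ∀ {n} p (xs ys : List (Edge n)) B f →
  expectFrom p (xs ++ ys) B f ≡ expectFrom p ys B (λ H → expectFrom p xs H f)
expectFrom-++ p []             ys B f = refl
expectFrom-++ p ((i , j) ∷ xs) ys B f =
  trans (cong₂ (mix p) (expectFrom-++ p xs ys B _) (expectFrom-++ p xs ys B _))
        (sym (expectFrom-linear p ys B p (1ℚ - p) _ _))

expectFrom-𝔼bits : ∀ {n} p (es : List (Edge n)) B t k (g : Graph n → List Bool → ℚ) →
  expectFrom p es B (λ G → 𝔼bits t k (g G)) ≡ 𝔼bits t k (λ b → expectFrom p es B (λ G → g G b))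
expectFrom-𝔼bits p es B t zero    g = refl
expectFrom-𝔼bits p es B t (suc k) g =
  trans (expectFrom-linear p es B t (1ℚ - t) _ _)
        (cong₂ (mix t) (expectFrom-𝔼bits p es B t k _) (expectFrom-𝔼bits p es B t k _))

assignOn : ∀ {n} → Graph n → List (Edge n) → List Bool → Graph n
assignOn H []             b = H
assignOn H ((i , j) ∷ es) b = setEdge i j (bit b 0) (assignOn H es (drop 1 b))

expectFrom≡𝔼bits : ∀ {n} p (es : List (Edge n)) H f →
  expectFrom p es H f ≡ 𝔼bits p (length es) (f ∘ assignOn H es)
expectFrom≡𝔼bits p []             H f = refl
expectFrom≡𝔼bits p ((i , j) ∷ es) H f =
  cong₂ (mix p) (expectFrom≡𝔼bits p es H _) (expectFrom≡𝔼bits p es H _)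

setEdge-same : ∀ {n} (i j : Fin n) b G → setEdge i j b G i j ≡ b
setEdge-same i j b G with i ≟ i | j ≟ j
... | yes _  | yes _  = refl
... | no i≢i | _      = ⊥-elim (i≢i refl)
... | yes _  | no j≢j = ⊥-elim (j≢j refl)

setEdge-other : ∀ {n} (i j : Fin n) b G x y → (i ≡ x → j ≡ y → ⊥) → setEdge i j b G x y ≡ G x y
setEdge-other i j b G x y ≢ij with i ≟ x | j ≟ y
... | yes i≡x | yes j≡y = ⊥-elim (≢ij i≡x j≡y)
... | yes _   | no _    = refl
... | no _    | yes _   = refl
... | no _    | no _    = refl

shiftEdge : ∀ {n} → Edge n → Edge (suc n)
shiftEdge (i , j) = (fs i , fs j)

firstRow : (k : ℕ) → List (Edge (suc k))
firstRow k = tabulate (λ j → (fz , fs j))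

pairs-suc : ∀ k → pairs (suc k) ≡ firstRow k ++ map shiftEdge (pairs k)
pairs-suc k = cong₂ _++_
  (trans (cong (map (fz ,_)) (filter-fz< id)) (map-tabulate fs (fz ,_)))
  (begin
    concat (map (row (suc k)) (tabulate fs))
  ≡⟨ cong concat (map-tabulate fs (row (suc k))) ⟩
    concat (tabulate (row (suc k) ∘ fs))
  ≡⟨ cong concat (tabulate-cong (row-fs k)) ⟩
    concat (tabulate (map shiftEdge ∘ row k))
  ≡⟨ cong concat (sym (map-tabulate (row k) (map shiftEdge))) ⟩
    concat (map (map shiftEdge) (tabulate (row k)))
  ≡⟨ concat-map (tabulate (row k)) ⟩
    map shiftEdge (concat (tabulate (row k)))
  ≡⟨ cong (map shiftEdge ∘ concat) (sym (map-tabulate id (row k))) ⟩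
    map shiftEdge (pairs k) ∎)
  where
  open ≡-Reasoning

  row : ∀ n → Fin n → List (Edge n)
  row n i = map (i ,_) (filter (i <?_) (tabulate id))

  filter-fz< : ∀ {m k} (g : Fin m → Fin k) → filter (fz {k} <?_) (tabulate (fs ∘ g)) ≡ tabulate (fs ∘ g)
  filter-fz< {zero}  g = refl
  filter-fz< {suc m} g = cong (fs (g fz) ∷_) (filter-fz< (g ∘ fs))

  filter-fs< : ∀ {m k} (i : Fin k) (g : Fin m → Fin k) →
    filter (fs i <?_) (tabulate (fs ∘ g)) ≡ map fs (filter (i <?_) (tabulate g))
  filter-fs< {zero}  i g = refl
  filter-fs< {suc m} i g with does (i <? g fz)
  ... | true  = cong (fs (g fz) ∷_) (filter-fs< i (g ∘ fs))
  ... | false = filter-fs< i (g ∘ fs)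

  row-fs : ∀ k (i : Fin k) → row (suc k) (fs i) ≡ map shiftEdge (row k i)
  row-fs k i = begin
      map (fs i ,_) (filter (fs i <?_) (tabulate fs))
    ≡⟨ cong (map (fs i ,_)) (filter-fs< i id) ⟩
      map (fs i ,_) (map fs (filter (i <?_) (tabulate id)))
    ≡⟨ sym (map-∘ _) ⟩
      map (λ j → (fs i , fs j)) (filter (i <?_) (tabulate id))
    ≡⟨ map-∘ _ ⟩
      map shiftEdge (row k i) ∎

_≗ᴳ_ : ∀ {k} → Graph k → Graph k → Set
G ≗ᴳ H = ∀ x y → G x y ≡ H x y

dropVertex : ∀ {k} → Graph (suc k) → Graph k
dropVertex G x y = G (fs x) (fs y)

assignOn-row-edge : ∀ {m K} (τ : Fin m → Fin K) → (∀ {a b} → τ a ≡ τ b → a ≡ b) → ∀ H b y →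
  assignOn H (tabulate (λ j → (fz , fs (τ j)))) b fz (fs (τ y)) ≡ bit b (toℕ y)
assignOn-row-edge τ τ-inj H b fz     = setEdge-same fz (fs (τ fz)) (bit b 0) _
assignOn-row-edge τ τ-inj H b (fs y) = begin
    setEdge fz (fs (τ fz)) (bit b 0) (assignOn H rest (drop 1 b)) fz (fs (τ (fs y)))
  ≡⟨ setEdge-other fz _ _ _ fz _ (λ _ e → 0≢1+n (τ-inj (fs-injective e))) ⟩
    assignOn H rest (drop 1 b) fz (fs (τ (fs y)))
  ≡⟨ assignOn-row-edge (τ ∘ fs) (fs-injective ∘ τ-inj) H (drop 1 b) y ⟩
    bit (drop 1 b) (toℕ y)
  ≡⟨ bit-drop 1 b (toℕ y) ⟩
    bit b (toℕ (fs y)) ∎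
  where
  open ≡-Reasoning
  rest = tabulate (λ j → (fz , fs (τ (fs j))))

assignOn-row-other : ∀ {m K} (τ : Fin m → Fin (suc K)) H b x y →
  assignOn H (tabulate (λ j → (fz , τ j))) b (fs x) y ≡ H (fs x) y
assignOn-row-other {zero}  τ H b x y = refl
assignOn-row-other {suc m} τ H b x y =
  trans (setEdge-other fz (τ fz) (bit b 0) (assignOn H rest (drop 1 b)) (fs x) y (λ e _ → 0≢1+n e))
        (assignOn-row-other (τ ∘ fs) H (drop 1 b) x y)
  where
  rest = tabulate (λ j → (fz , τ (fs j)))

firstRow-edge : ∀ {k} H b (y : Fin k) → assignOn H (firstRow k) b fz (fs y) ≡ bit b (toℕ y)
firstRow-edge = assignOn-row-edge id id

firstRow-drop : ∀ {k} H b → dropVertex (assignOn H (firstRow k) b) ≗ᴳ dropVertex H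
firstRow-drop H b x y = assignOn-row-other fs H b x (fs y)

setEdge-shift : ∀ {k} (i j : Fin k) b {H H↓} → dropVertex H ≗ᴳ H↓ →
  dropVertex (setEdge (fs i) (fs j) b H) ≗ᴳ setEdge i j b H↓
setEdge-shift i j b {H} {H↓} H≗ x y = by-cases (i ≟ x) (j ≟ y)
  where
  by-cases : Dec (i ≡ x) → Dec (j ≡ y) → setEdge (fs i) (fs j) b H (fs x) (fs y) ≡ setEdge i j b H↓ x y
  by-cases (yes refl) (yes refl) = trans (setEdge-same (fs i) (fs j) b H) (sym (setEdge-same i j b H↓))
  by-cases (no i≢x)   _          =
    trans (setEdge-other (fs i) (fs j) b H (fs x) (fs y) (λ e _ → i≢x (fs-injective e)))
          (trans (H≗ x y) (sym (setEdge-other i j b H↓ x y (λ e _ → i≢x e))))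
  by-cases (yes _)    (no j≢y)   =
    trans (setEdge-other (fs i) (fs j) b H (fs x) (fs y) (λ _ e → j≢y (fs-injective e)))
          (trans (H≗ x y) (sym (setEdge-other i j b H↓ x y (λ _ e → j≢y e))))

expectFrom-map-shift : ∀ {k} p (es : List (Edge k)) {B B↓} (f : Graph (suc k) → ℚ) (g : Graph k → ℚ) →
  (∀ {H H↓} → dropVertex H ≗ᴳ H↓ → f H ≡ g H↓) → dropVertex B ≗ᴳ B↓ →
  expectFrom p (map shiftEdge es) B f ≡ expectFrom p es B↓ g
expectFrom-map-shift p []             f g f≡g B≗ = f≡g B≗
expectFrom-map-shift p ((i , j) ∷ es) f g f≡g B≗ = cong₂ (mix p)
  (expectFrom-map-shift p es _ _ (f≡g ∘ setEdge-shift i j true) B≗)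
  (expectFrom-map-shift p es _ _ (f≡g ∘ setEdge-shift i j false) B≗)

𝟙ℕ : Bool → ℕ
𝟙ℕ true  = 1
𝟙ℕ false = 0

passHit : ∀ {k} → Graph (suc k) → (Fin (suc k) → Bool) → Fin k → Bool
passHit G hit y = hit (fs y) ∨ (hit fz ∧ G fz (fs y))

-- As paths increase, vertex 0 is reached only if it is hit, and if so it hits its neighbours;
-- hence a single sweep in increasing order counts the reached marked vertices.
countReached : ∀ {k} → Graph k → (hit mark : Fin k → Bool) → ℕ
countReached {zero}  G hit mark = 0
countReached {suc k} G hit mark =
  𝟙ℕ (hit fz ∧ mark fz) ℕ.+ countReached (dropVertex G) (passHit G hit) (mark ∘ fs)

countReached-cong : ∀ {k} {G H : Graph k} {hit₁ hit₂ mark₁ mark₂} →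
  G ≗ᴳ H → hit₁ ≗ hit₂ → mark₁ ≗ mark₂ → countReached G hit₁ mark₁ ≡ countReached H hit₂ mark₂
countReached-cong {zero}  G≗H hit≗ mark≗ = refl
countReached-cong {suc k} G≗H hit≗ mark≗ = cong₂ (λ a n → 𝟙ℕ a ℕ.+ n)
  (cong₂ _∧_ (hit≗ fz) (mark≗ fz))
  (countReached-cong (λ x y → G≗H (fs x) (fs y))
                     (λ y → cong₂ _∨_ (hit≗ (fs y)) (cong₂ _∧_ (hit≗ fz) (G≗H fz (fs y))))
                     (mark≗ ∘ fs))

𝔼reached : ℚ → (k : ℕ) → (hit mark : Fin k → Bool) → (ℕ → ℚ) → ℚ
𝔼reached p k hit mark Φ = 𝔼 k p (λ G → Φ (countReached G hit mark))

𝔼reached-cong : ∀ p k {hit₁ hit₂} mark (Φ : ℕ → ℚ) {Ψ} → hit₁ ≗ hit₂ → Φ ≗ Ψ →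
  𝔼reached p k hit₁ mark Φ ≡ 𝔼reached p k hit₂ mark Ψ
𝔼reached-cong p k mark Φ hit≗ Φ≗Ψ = expectOver-cong p (pairs k)
  (λ G → trans (cong Φ (countReached-cong {G = G} (λ _ _ → refl) hit≗ (λ _ → refl))) (Φ≗Ψ _))

-- Expose the k edges at vertex 0 first; b records which of them are present.
𝔼reached-suc : ∀ p k hit mark Φ → 𝔼reached p (suc k) hit mark Φ ≡
  𝔼bits p k (λ b → 𝔼reached p k (λ y → hit (fs y) ∨ (hit fz ∧ bit b (toℕ y))) (mark ∘ fs)
                                (λ X → Φ (𝟙ℕ (hit fz ∧ mark fz) ℕ.+ X)))
𝔼reached-suc p k hit mark Φ = begin
    expectOver p (pairs (suc k)) f
  ≡⟨ cong (λ es → expectOver p es f) (pairs-suc k) ⟩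
    expectOver p (firstRow k ++ map shiftEdge (pairs k)) f
  ≡⟨ expectOver≡expectFrom p (firstRow k ++ map shiftEdge (pairs k)) f ⟩
    expectFrom p (firstRow k ++ map shiftEdge (pairs k)) emptyGraph f
  ≡⟨ expectFrom-++ p (firstRow k) _ emptyGraph f ⟩
    expectFrom p (map shiftEdge (pairs k)) emptyGraph (λ H → expectFrom p (firstRow k) H f)
  ≡⟨ expectFrom-map-shift p (pairs k) _ (λ H↓ → 𝔼bits p k (λ b → g b H↓)) exposeFirstRow (λ _ _ → refl) ⟩
    expectFrom p (pairs k) emptyGraph (λ H↓ → 𝔼bits p k (λ b → g b H↓))
  ≡⟨ expectFrom-𝔼bits p (pairs k) emptyGraph p k (λ H↓ b → g b H↓) ⟩
    𝔼bits p k (λ b → expectFrom p (pairs k) emptyGraph (g b))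
  ≡⟨ 𝔼bits-cong p k (λ b → sym (expectOver≡expectFrom p (pairs k) (g b))) ⟩
    𝔼bits p k (λ b → 𝔼reached p k (hit↓ b) (mark ∘ fs) (λ X → Φ (c₀ ℕ.+ X))) ∎
  where
  open ≡-Reasoning
  f : Graph (suc k) → ℚ
  f G = Φ (countReached G hit mark)
  hit↓ : List Bool → Fin k → Bool
  hit↓ b y = hit (fs y) ∨ (hit fz ∧ bit b (toℕ y))
  c₀ = 𝟙ℕ (hit fz ∧ mark fz)
  g : List Bool → Graph k → ℚ
  g b H↓ = Φ (c₀ ℕ.+ countReached H↓ (hit↓ b) (mark ∘ fs))
  exposeFirstRow : ∀ {H H↓} → dropVertex H ≗ᴳ H↓ → expectFrom p (firstRow k) H f ≡ 𝔼bits p k (λ b → g b H↓)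
  exposeFirstRow {H} H≗ = begin
      expectFrom p (firstRow k) H f
    ≡⟨ expectFrom≡𝔼bits p (firstRow k) H f ⟩
      𝔼bits p (length (firstRow k)) (f ∘ assignOn H (firstRow k))
    ≡⟨ cong (λ n → 𝔼bits p n (f ∘ assignOn H (firstRow k)))
            (length-tabulate {n = k} (λ j → (fz {k} , fs j))) ⟩
      𝔼bits p k (f ∘ assignOn H (firstRow k))
    ≡⟨ 𝔼bits-cong p k (λ b → cong (λ X → Φ (c₀ ℕ.+ X)) (countReached-cong
         (λ x y → trans (firstRow-drop H b x y) (H≗ x y))
         (λ y → cong (λ e → hit (fs y) ∨ (hit fz ∧ e)) (firstRow-edge H b y))
         (λ _ → refl))) ⟩
      𝔼bits p k (λ b → g b _) ∎

-- The vertices below v, and vertex v + i whenever bit i of h is set.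
prefixOr : ℕ → List Bool → ℕ → Bool
prefixOr v h i = (i <ᵇ v) ∨ bit h (i ∸ v)

prefixOr-∨ : ∀ v h b i → prefixOr v h i ∨ bit b i ≡ prefixOr v (zipOr h (drop v b)) i
prefixOr-∨ zero    h b       i       = sym (bit-zipOr h b i)
prefixOr-∨ (suc v) h b       zero    = refl
prefixOr-∨ (suc v) h []      (suc i) =
  trans (prefixOr-∨ v h [] i) (cong (λ z → prefixOr v (zipOr h z) i) (drop-[] v))
prefixOr-∨ (suc v) h (x ∷ b) (suc i) = prefixOr-∨ v h b i

-- Exposing the first v vertices, all hit and none counted, leaves every later vertex hit
-- independently with probability 1 - (1 - p)^v.
𝔼reached-prefix : ∀ p v k h Φ → v ≤ k →
  𝔼reached p k (prefixOr v h ∘ toℕ) (λ x → not (toℕ x <ᵇ v)) Φ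
    ≡ 𝔼bits (1ℚ - (1ℚ - p) ^ v) (k ∸ v) (λ z → 𝔼reached p (k ∸ v) (bit (zipOr h z) ∘ toℕ) (λ _ → true) Φ)
𝔼reached-prefix p zero k h Φ z≤n = sym (begin
    𝔼bits 0ℚ k (λ z → 𝔼reached p k (bit (zipOr h z) ∘ toℕ) (λ _ → true) Φ)
  ≡⟨ 𝔼bits-zero k _ ⟩
    𝔼reached p k (bit (zipOr h (replicate k false)) ∘ toℕ) (λ _ → true) Φ
  ≡⟨ 𝔼reached-cong p k (λ _ → true) Φ (λ x → no-extra-bits (toℕ x)) (λ _ → refl) ⟩
    𝔼reached p k (bit h ∘ toℕ) (λ _ → true) Φ ∎)
  where
  open ≡-Reasoning
  no-extra-bits : ∀ i → bit (zipOr h (replicate k false)) i ≡ bit h i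
  no-extra-bits i =
    trans (bit-zipOr h _ i) (trans (cong (bit h i ∨_) (bit-replicate-false k i)) (∨-identityʳ _))
𝔼reached-prefix p (suc v) (suc k) h Φ (s≤s v≤k) = begin
    𝔼reached p (suc k) (prefixOr (suc v) h ∘ toℕ) mark Φ
  ≡⟨ 𝔼reached-suc p k (prefixOr (suc v) h ∘ toℕ) mark Φ ⟩
    𝔼bits p k (λ b → 𝔼reached p k (λ y → prefixOr v h (toℕ y) ∨ bit b (toℕ y)) (mark ∘ fs) Φ)
  ≡⟨ 𝔼bits-cong p k (λ b → 𝔼reached-cong p k (mark ∘ fs) Φ (λ y → prefixOr-∨ v h b (toℕ y)) (λ _ → refl)) ⟩
    𝔼bits p k (λ b → 𝔼reached p k (prefixOr v (zipOr h (drop v b)) ∘ toℕ) (mark ∘ fs) Φ)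
  ≡⟨ 𝔼bits-cong p k (λ b → 𝔼reached-prefix p v k (zipOr h (drop v b)) Φ v≤k) ⟩
    𝔼bits p k (G ∘ drop v)
  ≡⟨ cong (λ n → 𝔼bits p n (G ∘ drop v)) (sym (m+[n∸m]≡n v≤k)) ⟩
    𝔼bits p (v ℕ.+ (k ∸ v)) (G ∘ drop v)
  ≡⟨ 𝔼bits-drop p v (k ∸ v) G ⟩
    𝔼bits p (k ∸ v) G
  ≡⟨ 𝔼bits-cong p (k ∸ v) (λ w → 𝔼bits-cong t (k ∸ v) (λ z →
       𝔼reached-cong p (k ∸ v) (λ _ → true) Φ (λ x → bit-zipOr-assoc h w z (toℕ x)) (λ _ → refl))) ⟩
    𝔼bits p (k ∸ v) (λ w → 𝔼bits t (k ∸ v) (λ z → R (zipOr w z)))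
  ≡⟨ 𝔼bits-zipOr p t (k ∸ v) R ⟩
    𝔼bits (1ℚ - (1ℚ - p) * (1ℚ - t)) (k ∸ v) R
  ≡⟨ cong (λ t₂ → 𝔼bits t₂ (k ∸ v) R) (or-prob p ((1ℚ - p) ^ v)) ⟩
    𝔼bits (1ℚ - (1ℚ - p) ^ suc v) (k ∸ v) R ∎
  where
  open ≡-Reasoning
  mark : Fin (suc k) → Bool
  mark x = not (toℕ x <ᵇ suc v)
  t = 1ℚ - (1ℚ - p) ^ v
  G : List Bool → ℚ
  G w = 𝔼bits t (k ∸ v) (λ z → 𝔼reached p (k ∸ v) (bit (zipOr (zipOr h w) z) ∘ toℕ) (λ _ → true) Φ)
  R : List Bool → ℚ
  R u = 𝔼reached p (k ∸ v) (bit (zipOr h u) ∘ toℕ) (λ _ → true) Φ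
  or-prob : ∀ p x → 1ℚ - (1ℚ - p) * (1ℚ - (1ℚ - x)) ≡ 1ℚ - (1ℚ - p) * x
  or-prob = solve-∀ ℚ-ring

exactly : ℕ → ℕ → ℚ
exactly s X = 𝟙 ⌊ X ℕ.≟ s ⌋

exactly-suc : ∀ s X → exactly (suc s) (suc X) ≡ exactly s X
exactly-suc s X = cong 𝟙 (trans (isYes≗does (suc X ℕ.≟ suc s)) (sym (isYes≗does (X ℕ.≟ s))))

-- Probability that exactly s of m vertices get reached, when each is missed independently with
-- probability q^a and every vertex reached in turn multiplies the miss probabilities by q.
reachedLaw : ℚ → (m a s : ℕ) → ℚ
reachedLaw q zero    a zero    = 1ℚ
reachedLaw q zero    a (suc s) = 0ℚ
reachedLaw q (suc m) a zero    = mix (1ℚ - q ^ a) 0ℚ (reachedLaw q m a zero)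
reachedLaw q (suc m) a (suc s) = mix (1ℚ - q ^ a) (reachedLaw q m (suc a) s) (reachedLaw q m a (suc s))

𝔼reached-miss-first : ∀ p m h Φ →
  𝔼reached p (suc m) (bit (false ∷ h) ∘ toℕ) (λ _ → true) Φ ≡ 𝔼reached p m (bit h ∘ toℕ) (λ _ → true) Φ
𝔼reached-miss-first p m h Φ = trans (𝔼reached-suc p m (bit (false ∷ h) ∘ toℕ) (λ _ → true) Φ)
  (trans (𝔼bits-cong p m (λ b → 𝔼reached-cong p m (λ _ → true) Φ (λ y → ∨-identityʳ _) (λ _ → refl)))
         (𝔼bits-const p m _))

-- A hit at the first vertex adds an independent p-coin to every later vertex.
𝔼bits-𝔼reached-hit-first : ∀ p m a Φ →
  𝔼bits (1ℚ - (1ℚ - p) ^ a) m (λ h → 𝔼reached p (suc m) (bit (true ∷ h) ∘ toℕ) (λ _ → true) Φ)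
    ≡ 𝔼bits (1ℚ - (1ℚ - p) ^ suc a) m (λ u → 𝔼reached p m (bit u ∘ toℕ) (λ _ → true) (Φ ∘ suc))
𝔼bits-𝔼reached-hit-first p m a Φ = begin
    𝔼bits t m (λ h → 𝔼reached p (suc m) (bit (true ∷ h) ∘ toℕ) (λ _ → true) Φ)
  ≡⟨ 𝔼bits-cong t m (λ h → trans (𝔼reached-suc p m (bit (true ∷ h) ∘ toℕ) (λ _ → true) Φ)
       (𝔼bits-cong p m (λ b → 𝔼reached-cong p m (λ _ → true) (Φ ∘ suc)
                                 (λ y → sym (bit-zipOr h b (toℕ y))) (λ _ → refl)))) ⟩
    𝔼bits t m (λ h → 𝔼bits p m (λ b → R (zipOr h b)))
  ≡⟨ 𝔼bits-zipOr t p m R ⟩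
    𝔼bits (1ℚ - (1ℚ - t) * (1ℚ - p)) m R
  ≡⟨ cong (λ t₂ → 𝔼bits t₂ m R) (or-prob p ((1ℚ - p) ^ a)) ⟩
    𝔼bits (1ℚ - (1ℚ - p) ^ suc a) m R ∎
  where
  open ≡-Reasoning
  t = 1ℚ - (1ℚ - p) ^ a
  R : List Bool → ℚ
  R u = 𝔼reached p m (bit u ∘ toℕ) (λ _ → true) (Φ ∘ suc)
  or-prob : ∀ p r → 1ℚ - (1ℚ - (1ℚ - r)) * (1ℚ - p) ≡ 1ℚ - (1ℚ - p) * r
  or-prob = solve-∀ ℚ-ring

𝔼bits-𝔼reached≡reachedLaw : ∀ p m a s →
  𝔼bits (1ℚ - (1ℚ - p) ^ a) m (λ h → 𝔼reached p m (bit h ∘ toℕ) (λ _ → true) (exactly s))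
    ≡ reachedLaw (1ℚ - p) m a s
𝔼bits-𝔼reached≡reachedLaw p zero    a zero    = refl
𝔼bits-𝔼reached≡reachedLaw p zero    a (suc s) = refl
𝔼bits-𝔼reached≡reachedLaw p (suc m) a zero    = cong₂ (mix (1ℚ - (1ℚ - p) ^ a))
  (trans (𝔼bits-𝔼reached-hit-first p m a (exactly zero))
    (trans (𝔼bits-cong _ m (λ u → expectOver-const p (pairs m) 0ℚ)) (𝔼bits-const _ m 0ℚ)))
  (trans (𝔼bits-cong _ m (λ h → 𝔼reached-miss-first p m h (exactly zero)))
         (𝔼bits-𝔼reached≡reachedLaw p m a zero))
𝔼bits-𝔼reached≡reachedLaw p (suc m) a (suc s) = cong₂ (mix (1ℚ - (1ℚ - p) ^ a))
  (trans (𝔼bits-𝔼reached-hit-first p m a (exactly (suc s)))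
    (trans (𝔼bits-cong _ m (λ u → 𝔼reached-cong p m (λ _ → true) (exactly (suc s) ∘ suc)
                                                 (λ _ → refl) (exactly-suc s)))
           (𝔼bits-𝔼reached≡reachedLaw p m (suc a) s)))
  (trans (𝔼bits-cong _ m (λ h → 𝔼reached-miss-first p m h (exactly (suc s))))
         (𝔼bits-𝔼reached≡reachedLaw p m a (suc s)))

-- The q-binomial law

prodFrom-cong : ∀ a k {f g : ℕ → ℚ} → (∀ i → f i ≡ g i) → prodFrom a k f ≡ prodFrom a k g
prodFrom-cong a zero    f≗g = refl
prodFrom-cong a (suc k) f≗g = cong₂ _*_ (f≗g a) (prodFrom-cong (suc a) k f≗g)

prodFrom-shift : ∀ a b k (f : ℕ → ℚ) → prodFrom a k (λ j → f (j ℕ.+ b)) ≡ prodFrom (a ℕ.+ b) k f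
prodFrom-shift a b zero    f = refl
prodFrom-shift a b (suc k) f = cong (f (a ℕ.+ b) *_) (prodFrom-shift (suc a) b k f)

prodFrom-snoc : ∀ a k (f : ℕ → ℚ) → prodFrom a (suc k) f ≡ prodFrom a k f * f (a ℕ.+ k)
prodFrom-snoc a zero    f = begin
  f a * 1ℚ          ≡⟨ *-identityʳ (f a) ⟩
  f a               ≡⟨ cong f (sym (+-identityʳ a)) ⟩
  f (a ℕ.+ 0)       ≡⟨ sym (*-identityˡ _) ⟩
  1ℚ * f (a ℕ.+ 0)  ∎
  where open ≡-Reasoning
prodFrom-snoc a (suc k) f = begin
    f a * prodFrom (suc a) (suc k) f
  ≡⟨ cong (f a *_) (prodFrom-snoc (suc a) k f) ⟩
    f a * (prodFrom (suc a) k f * f (suc a ℕ.+ k))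
  ≡⟨ sym (*-assoc (f a) _ _) ⟩
    f a * prodFrom (suc a) k f * f (suc a ℕ.+ k)
  ≡⟨ cong (λ i → f a * prodFrom (suc a) k f * f i) (sym (+-suc a k)) ⟩
    f a * prodFrom (suc a) k f * f (a ℕ.+ suc k) ∎
  where open ≡-Reasoning

prodFrom-zero : ∀ a k (f : ℕ → ℚ) j → a ≤ j → j ℕ.< a ℕ.+ k → f j ≡ 0ℚ → prodFrom a k f ≡ 0ℚ
prodFrom-zero a zero    f j a≤j j<a+0 fj≡0 =
  ⊥-elim (ℕₚ.<-irrefl refl (ℕₚ.≤-trans j<a+0 (subst (_≤ j) (sym (+-identityʳ a)) a≤j)))
prodFrom-zero a (suc k) f j a≤j j<a+k fj≡0 with m≤n⇒m<n∨m≡n a≤j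
... | inj₂ refl = trans (cong (_* prodFrom (suc a) k f) fj≡0) (*-zeroˡ (prodFrom (suc a) k f))
... | inj₁ a<j  =
  trans (cong (f a *_) (prodFrom-zero (suc a) k f j a<j (subst (j ℕ.<_) (+-suc a k) j<a+k) fj≡0))
        (*-zeroʳ (f a))

prodFrom-⊘ : ∀ a k (f g : ℕ → ℚ) → (∀ i → a ≤ i → g i ≢ 0ℚ) →
  prodFrom a k (λ i → f i ⊘ g i) * prodFrom a k g ≡ prodFrom a k f
prodFrom-⊘ a zero    f g g≢0 = refl
prodFrom-⊘ a (suc k) f g g≢0 = trans (interchange (f a ⊘ g a) (g a) _ _)
  (cong₂ _*_ (⊘-cancelʳ (f a) (g a) (g≢0 a ℕₚ.≤-refl))
             (prodFrom-⊘ (suc a) k f g (λ i a<i → g≢0 i (ℕₚ.<⇒≤ a<i))))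
  where
  interchange : ∀ x y X Y → x * X * (y * Y) ≡ x * y * (X * Y)
  interchange = solve-∀ ℚ-ring

poch : ℚ → ℕ → ℕ → ℚ
poch q a s = prodFrom a s (λ k → 1ℚ - q ^ k)

-- The Gaussian binomial coefficient [s + t choose s]_q, by the q-Pascal rule.
qBinomial : ℚ → ℕ → ℕ → ℚ
qBinomial q zero    t       = 1ℚ
qBinomial q (suc s) zero    = 1ℚ
qBinomial q (suc s) (suc t) = qBinomial q (suc s) t + q ^ suc t * qBinomial q s (suc t)

qBinomial-zeroʳ : ∀ q s → qBinomial q s zero ≡ 1ℚ
qBinomial-zeroʳ q zero    = refl
qBinomial-zeroʳ q (suc s) = refl

qBinomial-*-poch : ∀ q s t → qBinomial q s t * poch q 1 s ≡ poch q (suc t) s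
qBinomial-*-poch q zero    t       = refl
qBinomial-*-poch q (suc s) zero    = *-identityˡ _
qBinomial-*-poch q (suc s) (suc t) = begin
    (X + Q * Y) * poch q 1 (suc s)
  ≡⟨ *-distribʳ-+ (poch q 1 (suc s)) X (Q * Y) ⟩
    X * poch q 1 (suc s) + Q * Y * poch q 1 (suc s)
  ≡⟨ cong (λ z → X * poch q 1 (suc s) + Q * Y * z) (prodFrom-snoc 1 s _) ⟩
    X * poch q 1 (suc s) + Q * Y * (poch q 1 s * (1ℚ - W))
  ≡⟨ cong (λ z → X * poch q 1 (suc s) + z) (regroup Q Y (poch q 1 s) (1ℚ - W)) ⟩
    X * poch q 1 (suc s) + Q * (Y * poch q 1 s) * (1ℚ - W)
  ≡⟨ cong₂ (λ x y → x + Q * y * (1ℚ - W)) (qBinomial-*-poch q (suc s) t) (qBinomial-*-poch q s (suc t)) ⟩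
    (1ℚ - Q) * R + Q * R * (1ℚ - W)
  ≡⟨ collect Q W R ⟩
    R * (1ℚ - Q * W)
  ≡⟨ cong (λ x → R * (1ℚ - x)) (sym (trans (cong (q ^_) (sym (+-suc (suc t) s))) (^-+ q (suc t) (suc s)))) ⟩
    R * (1ℚ - q ^ (suc (suc t) ℕ.+ s))
  ≡⟨ sym (prodFrom-snoc (suc (suc t)) s _) ⟩
    poch q (suc (suc t)) (suc s) ∎
  where
  open ≡-Reasoning
  Q = q ^ suc t
  W = q ^ suc s
  R = poch q (suc (suc t)) s
  X = qBinomial q (suc s) t
  Y = qBinomial q s (suc t)
  regroup : ∀ Q Y D E → Q * Y * (D * E) ≡ Q * (Y * D) * E
  regroup = solve-∀ ℚ-ring
  collect : ∀ Q W R → (1ℚ - Q) * R + Q * R * (1ℚ - W) ≡ R * (1ℚ - Q * W)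
  collect = solve-∀ ℚ-ring

reachedLaw-vanishes : ∀ q m a s → m ℕ.< s → reachedLaw q m a s ≡ 0ℚ
reachedLaw-vanishes q zero    a (suc s) _         = refl
reachedLaw-vanishes q (suc m) a (suc s) (s≤s m<s) = trans
  (cong₂ (mix (1ℚ - q ^ a)) (reachedLaw-vanishes q m (suc a) s m<s)
                            (reachedLaw-vanishes q m a (suc s) (m≤n⇒m≤1+n m<s)))
  (mix-const (1ℚ - q ^ a) 0ℚ)

reachedLaw-closed : ∀ q m a s t → s ℕ.+ t ≡ m →
  reachedLaw q m a s ≡ q ^ (a ℕ.* t) * poch q a s * qBinomial q s t
reachedLaw-closed q zero    a zero    zero    refl = sym (cong (λ e → q ^ e * 1ℚ * 1ℚ) (ℕₚ.*-zeroʳ a))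
reachedLaw-closed q (suc m) a zero    (suc m) refl = begin
    mix (1ℚ - r) 0ℚ (reachedLaw q m a zero)
  ≡⟨ cong (mix (1ℚ - r) 0ℚ) (reachedLaw-closed q m a zero m refl) ⟩
    mix (1ℚ - r) 0ℚ (q ^ (a ℕ.* m) * 1ℚ * 1ℚ)
  ≡⟨ miss r (q ^ (a ℕ.* m)) ⟩
    r * q ^ (a ℕ.* m) * 1ℚ * 1ℚ
  ≡⟨ cong (λ x → x * 1ℚ * 1ℚ) (sym (trans (cong (q ^_) (*-suc a m)) (^-+ q a (a ℕ.* m)))) ⟩
    q ^ (a ℕ.* suc m) * 1ℚ * 1ℚ ∎
  where
  open ≡-Reasoning
  r = q ^ a
  miss : ∀ r X → (1ℚ - r) * 0ℚ + (1ℚ - (1ℚ - r)) * (X * 1ℚ * 1ℚ) ≡ r * X * 1ℚ * 1ℚ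
  miss = solve-∀ ℚ-ring
reachedLaw-closed q (suc m) a (suc s) zero    s+0≡1+m = begin
    mix (1ℚ - r) (reachedLaw q m (suc a) s) (reachedLaw q m a (suc s))
  ≡⟨ cong₂ (mix (1ℚ - r)) (reachedLaw-closed q m (suc a) s zero s+0≡m)
                          (reachedLaw-vanishes q m a (suc s) m<1+s) ⟩
    mix (1ℚ - r) (Z * P * qBinomial q s zero) 0ℚ
  ≡⟨ cong (λ x → mix (1ℚ - r) (Z * P * x) 0ℚ) (qBinomial-zeroʳ q s) ⟩
    mix (1ℚ - r) (Z * P * 1ℚ) 0ℚ
  ≡⟨ hit r Z P ⟩
    Z * ((1ℚ - r) * P) * 1ℚ ∎
  where
  open ≡-Reasoning
  r = q ^ a
  Z = q ^ (a ℕ.* zero)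
  P = poch q (suc a) s
  s+0≡m = suc-injective s+0≡1+m
  m<1+s : m ℕ.< suc s
  m<1+s = s≤s (subst (_≤ s) s+0≡m (ℕₚ.≤-reflexive (+-identityʳ s)))
  hit : ∀ r Z P → (1ℚ - r) * (Z * P * 1ℚ) + (1ℚ - (1ℚ - r)) * 0ℚ ≡ Z * ((1ℚ - r) * P) * 1ℚ
  hit = solve-∀ ℚ-ring
reachedLaw-closed q (suc m) a (suc s) (suc t) s+t≡m = begin
    mix (1ℚ - r) (reachedLaw q m (suc a) s) (reachedLaw q m a (suc s))
  ≡⟨ cong₂ (mix (1ℚ - r)) (reachedLaw-closed q m (suc a) s (suc t) s+1+t≡m)
                          (reachedLaw-closed q m a (suc s) t (trans (sym (+-suc s t)) s+1+t≡m)) ⟩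
    mix (1ℚ - r) (q ^ (suc a ℕ.* suc t) * P * Y) (X * ((1ℚ - r) * P) * Z)
  ≡⟨ cong (λ x → mix (1ℚ - r) (x * P * Y) (X * ((1ℚ - r) * P) * Z))
          (trans (^-+ q (suc t) (a ℕ.* suc t)) (cong (Q *_) q^[a*1+t])) ⟩
    mix (1ℚ - r) (Q * (r * X) * P * Y) (X * ((1ℚ - r) * P) * Z)
  ≡⟨ pascal r X Q P Y Z ⟩
    r * X * ((1ℚ - r) * P) * (Z + Q * Y)
  ≡⟨ cong (λ x → x * ((1ℚ - r) * P) * (Z + Q * Y)) (sym q^[a*1+t]) ⟩
    q ^ (a ℕ.* suc t) * poch q a (suc s) * qBinomial q (suc s) (suc t) ∎
  where
  open ≡-Reasoning
  r = q ^ a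
  Q = q ^ suc t
  X = q ^ (a ℕ.* t)
  P = poch q (suc a) s
  Y = qBinomial q s (suc t)
  Z = qBinomial q (suc s) t
  s+1+t≡m = suc-injective s+t≡m
  q^[a*1+t] : q ^ (a ℕ.* suc t) ≡ r * X
  q^[a*1+t] = trans (cong (q ^_) (*-suc a t)) (^-+ q a (a ℕ.* t))
  pascal : ∀ r X Q P Y Z → (1ℚ - r) * (Q * (r * X) * P * Y) + (1ℚ - (1ℚ - r)) * (X * ((1ℚ - r) * P) * Z)
                         ≡ r * X * ((1ℚ - r) * P) * (Z + Q * Y)
  pascal = solve-∀ ℚ-ring

module _ {q : ℚ} (0≤q : 0ℚ ≤ℚ q) (q<1 : q < 1ℚ) where

  ^≤1 : ∀ i → q ^ i ≤ℚ 1ℚ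
  ^≤1 zero    = ℚₚ.≤-refl
  ^≤1 (suc i) = ℚₚ.≤-trans (ℚₚ.*-monoˡ-≤-nonNeg q {{nonNegative 0≤q}} (^≤1 i))
                           (ℚₚ.≤-trans (ℚₚ.≤-reflexive (*-identityʳ q)) (ℚₚ.<⇒≤ q<1))

  1-^suc-pos : ∀ i → Positive (1ℚ - q ^ suc i)
  1-^suc-pos i =
    positive (subst (_< 1ℚ - q ^ suc i) (ℚₚ.+-inverseʳ (q ^ suc i)) (ℚₚ.+-monoˡ-< (- (q ^ suc i)) ^suc<1))
    where
    ^suc<1 : q ^ suc i < 1ℚ
    ^suc<1 = ℚₚ.≤-<-trans (ℚₚ.≤-trans (ℚₚ.*-monoˡ-≤-nonNeg q {{nonNegative 0≤q}} (^≤1 i))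
                                     (ℚₚ.≤-reflexive (*-identityʳ q))) q<1

  1-^≢0 : ∀ i → 1 ≤ i → 1ℚ - q ^ i ≢ 0ℚ
  1-^≢0 (suc i) _ x≡0 = ℚₚ.<⇒≢ (ℚₚ.positive⁻¹ _ {{1-^suc-pos i}}) (sym x≡0)

  poch-pos : ∀ a s → Positive (poch q (suc a) s)
  poch-pos a zero    = _
  poch-pos a (suc s) =
    ℚₚ.pos*pos⇒pos (1ℚ - q ^ suc a) {{1-^suc-pos a}} (poch q (suc (suc a)) s) {{poch-pos (suc a) s}}

  qBinomial-as-product : ∀ s t → prodFrom 1 s (λ i → (1ℚ - q ^ (i ℕ.+ t)) ⊘ (1ℚ - q ^ i)) ≡ qBinomial q s t
  qBinomial-as-product s t = *-cancelʳ-pos (poch q 1 s) {{poch-pos 0 s}} (begin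
      prodFrom 1 s (λ i → (1ℚ - q ^ (i ℕ.+ t)) ⊘ (1ℚ - q ^ i)) * poch q 1 s
    ≡⟨ prodFrom-⊘ 1 s _ _ 1-^≢0 ⟩
      prodFrom 1 s (λ i → 1ℚ - q ^ (i ℕ.+ t))
    ≡⟨ prodFrom-shift 1 t s _ ⟩
      poch q (suc t) s
    ≡⟨ sym (qBinomial-*-poch q s t) ⟩
      qBinomial q s t * poch q 1 s ∎)
    where open ≡-Reasoning

  closedForm≡reachedLaw : ∀ M v s →
    q ^ℤ (+ v ℤ.* (+ M ℤ.- + s)) * prodFrom 0 s (λ j → 1ℚ - q ^ (j ℕ.+ v))
      * prodFrom 1 s (λ i → (1ℚ - q ^ℤ (+ M ℤ.- + s ℤ.+ + i)) ⊘ (1ℚ - q ^ i))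
    ≡ reachedLaw q M v s
  closedForm≡reachedLaw M v s with ℕₚ.≤-<-connex s M
  ... | inj₁ s≤M = begin
      q ^ℤ (+ v ℤ.* (+ M ℤ.- + s)) * prodFrom 0 s (λ j → 1ℚ - q ^ (j ℕ.+ v))
        * prodFrom 1 s (λ i → (1ℚ - q ^ℤ (+ M ℤ.- + s ℤ.+ + i)) ⊘ (1ℚ - q ^ i))
    ≡⟨ cong₂ (λ e x → q ^ℤ e * prodFrom 0 s (λ j → 1ℚ - q ^ (j ℕ.+ v)) * x)
             (trans (cong (+ v ℤ.*_) M-s≡t) (sym (ℤₚ.pos-* v t)))
             (prodFrom-cong 1 s (λ i → cong (λ e → (1ℚ - q ^ℤ e) ⊘ (1ℚ - q ^ i))
               (trans (cong (ℤ._+ + i) M-s≡t) (trans (sym (ℤₚ.pos-+ t i)) (cong +_ (ℕₚ.+-comm t i)))))) ⟩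
      q ^ (v ℕ.* t) * prodFrom 0 s (λ j → 1ℚ - q ^ (j ℕ.+ v))
        * prodFrom 1 s (λ i → (1ℚ - q ^ (i ℕ.+ t)) ⊘ (1ℚ - q ^ i))
    ≡⟨ cong₂ (λ x y → q ^ (v ℕ.* t) * x * y) (prodFrom-shift 0 v s _) (qBinomial-as-product s t) ⟩
      q ^ (v ℕ.* t) * poch q v s * qBinomial q s t
    ≡⟨ sym (reachedLaw-closed q M v s t (m+[n∸m]≡n s≤M)) ⟩
      reachedLaw q M v s ∎
    where
    open ≡-Reasoning
    t = M ∸ s
    M-s≡t : + M ℤ.- + s ≡ + t
    M-s≡t = trans (ℤₚ.[+m]-[+n]≡m⊖n M s) (ℤₚ.⊖-≥ s≤M)
  ... | inj₂ M<s = begin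
      X * prodFrom 1 s (λ i → (1ℚ - q ^ℤ (+ M ℤ.- + s ℤ.+ + i)) ⊘ (1ℚ - q ^ i))
    ≡⟨ cong (X *_) (prodFrom-zero 1 s _ (s ∸ M) (ℕₚ.m<n⇒0<n∸m M<s) (s≤s (ℕₚ.m∸n≤m s M)) factor-vanishes) ⟩
      X * 0ℚ
    ≡⟨ *-zeroʳ X ⟩
      0ℚ
    ≡⟨ sym (reachedLaw-vanishes q M v s M<s) ⟩
      reachedLaw q M v s ∎
    where
    open ≡-Reasoning
    X = q ^ℤ (+ v ℤ.* (+ M ℤ.- + s)) * prodFrom 0 s (λ j → 1ℚ - q ^ (j ℕ.+ v))
    factor-vanishes : (1ℚ - q ^ℤ (+ M ℤ.- + s ℤ.+ + (s ∸ M))) ⊘ (1ℚ - q ^ (s ∸ M)) ≡ 0ℚ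
    factor-vanishes = trans
      (cong (λ e → (1ℚ - q ^ℤ e) ⊘ (1ℚ - q ^ (s ∸ M)))
        (trans (cong (ℤ._+ + (s ∸ M)) (trans (ℤₚ.[+m]-[+n]≡m⊖n M s) (ℤₚ.⊖-≤ (ℕₚ.<⇒≤ M<s))))
               (ℤₚ.+-inverseˡ (+ (s ∸ M)))))
      (⊘-zeroˡ (1ℚ - q ^ (s ∸ M)))

-- Up-sets are reached sets

data Reached {k} (G : Graph k) (hit : Fin k → Bool) : Fin k → Set where
  source : ∀ {x} → T (hit x) → Reached G hit x
  extend : ∀ {y x} → y <ᶠ x → Reached G hit y → G y x ≡ true → Reached G hit x

Reached-fz : ∀ {k} {G : Graph (suc k)} {hit} → Reached G hit fz → T (hit fz)
Reached-fz (source t) = t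

Reached-fs⁻ : ∀ {k} {G : Graph (suc k)} {hit x} →
  Reached G hit (fs x) → Reached (dropVertex G) (passHit G hit) x
Reached-fs⁻ (source t)                 = source (Equivalence.from T-∨ (inj₁ t))
Reached-fs⁻ (extend {fz}   _       r e) =
  source (Equivalence.from T-∨ (inj₂ (Equivalence.from T-∧ (Reached-fz r , Equivalence.from T-≡ e))))
Reached-fs⁻ (extend {fs y} (s≤s y<x) r e) = extend y<x (Reached-fs⁻ r) e

Reached-fs⁺ : ∀ {k} {G : Graph (suc k)} {hit x} →
  Reached (dropVertex G) (passHit G hit) x → Reached G hit (fs x)
Reached-fs⁺ (source t) with Equivalence.to T-∨ t
... | inj₁ t-hit = source t-hit
... | inj₂ t-edge with Equivalence.to T-∧ t-edge
...   | t-hit₀ , t-edge₀ = extend (s≤s z≤n) (source t-hit₀) (Equivalence.to T-≡ t-edge₀)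
Reached-fs⁺ (extend y<x r e) = extend (s≤s y<x) (Reached-fs⁺ r) e

countTrue : ∀ {k} → (Fin k → Bool) → ℕ
countTrue {zero}  P = 0
countTrue {suc k} P = 𝟙ℕ (P fz) ℕ.+ countTrue (P ∘ fs)

countTrue-cong : ∀ {k} {P Q : Fin k → Bool} → P ≗ Q → countTrue P ≡ countTrue Q
countTrue-cong {zero}  P≗Q = refl
countTrue-cong {suc k} P≗Q = cong₂ (λ b n → 𝟙ℕ b ℕ.+ n) (P≗Q fz) (countTrue-cong (P≗Q ∘ fs))

countTrue≡countReached : ∀ {k} (G : Graph k) hit mark (reached? : ∀ x → Dec (Reached G hit x)) →
  countTrue (λ x → does (reached? x) ∧ mark x) ≡ countReached G hit mark
countTrue≡countReached {zero}  G hit mark reached? = refl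
countTrue≡countReached {suc k} G hit mark reached? = cong₂ (λ b n → 𝟙ℕ (b ∧ mark fz) ℕ.+ n)
  (det (proof (reached? fz)) (fromEquivalence source Reached-fz))
  (countTrue≡countReached (dropVertex G) (passHit G hit) (mark ∘ fs)
    (λ x → map′ Reached-fs⁻ Reached-fs⁺ (reached? (fs x))))

IncPath-snoc : ∀ {k} {G : Graph k} {a b c} → IncPath G a b → b <ᶠ c → G b c ≡ true → IncPath G a c
IncPath-snoc (edge a<b e)   b<c e′ = step a<b e (edge b<c e′)
IncPath-snoc (step a<d e p) b<c e′ = step a<d e (IncPath-snoc p b<c e′)

Reached-IncPath : ∀ {k} {G : Graph k} {hit i j} → Reached G hit i → IncPath G i j → Reached G hit j
Reached-IncPath r (edge i<j e)   = extend i<j r e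
Reached-IncPath r (step i<k e p) = Reached-IncPath (extend i<k r e) p

module _ {k} {G : Graph k} {V : Subset k} {hit : Fin k → Bool} (hit⇔V : ∀ y → T (hit y) ⇔ y ∈ V) where

  ∈Up⇒Reached : ∀ {x} → x ∈Up[ G , V ] → Reached G hit x
  ∈Up⇒Reached (y , y∈V , inj₁ refl) = source (Equivalence.from (hit⇔V y) y∈V)
  ∈Up⇒Reached (y , y∈V , inj₂ p)    = Reached-IncPath (source (Equivalence.from (hit⇔V y) y∈V)) p

  Reached⇒∈Up : ∀ {x} → Reached G hit x → x ∈Up[ G , V ]
  Reached⇒∈Up {x} (source t) = x , Equivalence.to (hit⇔V x) t , inj₁ refl
  Reached⇒∈Up (extend y<x r e) with Reached⇒∈Up r
  ... | z , z∈V , inj₁ refl = z , z∈V , inj₂ (edge y<x e)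
  ... | z , z∈V , inj₂ p    = z , z∈V , inj₂ (IncPath-snoc p y<x e)

length-filter-filter : ∀ {k n ℓ₁ ℓ₂} {P : Pred (Fin n) ℓ₁} {Q : Pred (Fin n) ℓ₂}
  (P? : Decidable P) (Q? : Decidable Q) (f : Fin k → Fin n) →
  length (filter Q? (filter P? (tabulate f))) ≡ countTrue (λ x → does (P? (f x)) ∧ does (Q? (f x)))
length-filter-filter {zero}  P? Q? f = refl
length-filter-filter {suc k} P? Q? f with does (P? (f fz))
... | false = length-filter-filter P? Q? (f ∘ fs)
... | true with does (Q? (f fz))
...   | false = length-filter-filter P? Q? (f ∘ fs)
...   | true  = cong suc (length-filter-filter P? Q? (f ∘ fs))

DownClosed : ∀ {n} → Subset n → Set
DownClosed V = ∀ {x y} → toℕ x ℕ.< toℕ y → y ∈ V → x ∈ V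

downClosed⇒∈⇔<∣∣ : ∀ {n} {V : Subset n} → DownClosed V → ∀ x → x ∈ V ⇔ toℕ x ℕ.< ∣ V ∣
downClosed⇒∈⇔<∣∣ {V = inside ∷ V} closed fz     = mk⇔ (λ _ → s≤s z≤n) (λ _ → here)
downClosed⇒∈⇔<∣∣ {V = inside ∷ V} closed (fs x) =
  mk⇔ (λ x∈V → s≤s (Equivalence.to (tail x) (drop-there x∈V)))
      (λ { (s≤s x<∣V∣) → there (Equivalence.from (tail x) x<∣V∣) })
  where
  tail : ∀ x → x ∈ V ⇔ toℕ x ℕ.< ∣ V ∣
  tail = downClosed⇒∈⇔<∣∣ (λ x<y y∈V → drop-there (closed (s≤s x<y) (there y∈V)))
downClosed⇒∈⇔<∣∣ {suc n} {V = outside ∷ V} closed x =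
  mk⇔ (λ x∈V → ⊥-elim (empty (x , x∈V)))
      (λ x<∣V∣ → ⊥-elim (ℕₚ.n≮0 (subst (toℕ x ℕ.<_) ∣V∣≡0 x<∣V∣)))
  where
  empty : Empty (outside ∷ V)
  empty (fs y , y∈V) with closed {x = fz} (s≤s z≤n) y∈V
  ... | ()
  ∣V∣≡0 : ∣ outside ∷ V ∣ ≡ 0
  ∣V∣≡0 = trans (cong ∣_∣ (Empty-unique empty)) (∣⊥∣≡0 (suc n))

n*1/n≡1 : ∀ n .{{_ : NonZero n}} → (+ n Data.Rational./ 1) * (+ 1 Data.Rational./ n) ≡ 1ℚ
n*1/n≡1 (suc n) = ℚₚ.toℚᵘ-injective
  (ℚᵘₚ.≃-trans (ℚₚ.toℚᵘ-homo-* (+ suc n Data.Rational./ 1) (+ 1 Data.Rational./ suc n))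
  (ℚᵘₚ.≃-trans (ℚᵘₚ.*-cong (ℚₚ.toℚᵘ-fromℚᵘ (mkℚᵘ (+ suc n) 0)) (ℚₚ.toℚᵘ-fromℚᵘ (mkℚᵘ (+ 1) n)))
               (ℚᵘₚ.*-inverseʳ (mkℚᵘ (+ suc n) 0))))

module _ (c : ℚ) (n : ℕ) .{{_ : NonZero n}} (0<c : 0ℚ < c) (c≤n : c ≤ℚ (+ n Data.Rational./ 1)) where

  private
    1/n = + 1 Data.Rational./ n
    0<1/n : 0ℚ < 1/n
    0<1/n = ℚₚ.positive⁻¹ 1/n {{ℚₚ.normalize-pos 1 n}}

  0<pOf : 0ℚ < pOf c n
  0<pOf = ℚₚ.positive⁻¹ _ {{ℚₚ.pos*pos⇒pos c {{positive 0<c}} 1/n {{positive 0<1/n}}}}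

  0≤qOf : 0ℚ ≤ℚ qOf c n
  0≤qOf = subst (_≤ℚ qOf c n) (ℚₚ.+-inverseʳ (pOf c n)) (ℚₚ.+-monoˡ-≤ (- pOf c n) pOf≤1)
    where
    pOf≤1 : pOf c n ≤ℚ 1ℚ
    pOf≤1 = ℚₚ.≤-trans (ℚₚ.*-monoʳ-≤-nonNeg 1/n {{nonNegative (ℚₚ.<⇒≤ 0<1/n)}} c≤n)
                       (ℚₚ.≤-reflexive (n*1/n≡1 n))

  qOf<1 : qOf c n < 1ℚ
  qOf<1 = subst (qOf c n <_) (ℚₚ.+-identityʳ 1ℚ) (ℚₚ.+-monoʳ-< 1ℚ (ℚₚ.neg-antimono-< 0<pOf))

module _ {n} (U V : Subset n) (cover : ∀ x → x ∈ U ⊎ x ∈ V) (disjoint : ∀ x → ¬ (x ∈ U × x ∈ V))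
         (V<U : ∀ x y → x ∈ V → y ∈ U → toℕ x ℕ.< toℕ y) where

  ∈V⇔<∣V∣ : ∀ x → x ∈ V ⇔ toℕ x ℕ.< ∣ V ∣
  ∈V⇔<∣V∣ = downClosed⇒∈⇔<∣∣ V-downClosed
    where
    V-downClosed : DownClosed V
    V-downClosed {x} {y} x<y y∈V with cover x
    ... | inj₂ x∈V = x∈V
    ... | inj₁ x∈U = ⊥-elim (ℕₚ.<-asym x<y (V<U y x y∈V x∈U))

  ∈U⇔≮∣V∣ : ∀ x → x ∈ U ⇔ (¬ toℕ x ℕ.< ∣ V ∣)
  ∈U⇔≮∣V∣ x = mk⇔ (λ x∈U x<∣V∣ → disjoint x (x∈U , Equivalence.from (∈V⇔<∣V∣ x) x<∣V∣))
                  (λ x≮∣V∣ → [ id , (λ x∈V → ⊥-elim (x≮∣V∣ (Equivalence.to (∈V⇔<∣V∣ x) x∈V))) ] (cover x))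

  ∣U∣≡n∸∣V∣ : ∣ U ∣ ≡ n ∸ ∣ V ∣
  ∣U∣≡n∸∣V∣ = trans (cong ∣_∣ U≡∁V) (∣∁p∣≡n∸∣p∣ V)
    where
    U≡∁V : U ≡ ∁ V
    U≡∁V = ⊆-antisym (λ {x} x∈U → x∉p⇒x∈∁p (λ x∈V → disjoint x (x∈U , x∈V)))
                     (λ {x} x∈∁V → [ id , (λ x∈V → ⊥-elim (x∈∁p⇒x∉p x∈∁V x∈V)) ] (cover x))

  countUpIn≡countReached : (G : Graph n) (dec : ∀ x → Dec (x ∈Up[ G , V ])) →
    countUpIn G V U dec ≡ countReached G (λ x → toℕ x <ᵇ ∣ V ∣) (λ x → not (toℕ x <ᵇ ∣ V ∣))
  countUpIn≡countReached G dec = begin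
      countUpIn G V U dec
    ≡⟨ length-filter-filter dec (_∈? U) id ⟩
      countTrue (λ x → does (dec x) ∧ does (x ∈? U))
    ≡⟨ countTrue-cong (λ x → cong (does (dec x) ∧_) (does-⇔ (∈U⇔≮∣V∣ x) (x ∈? U) (¬? (toℕ x ℕ.<? ∣ V ∣)))) ⟩
      countTrue (λ x → does (dec x) ∧ not (toℕ x <ᵇ ∣ V ∣))
    ≡⟨ countTrue≡countReached G _ _ (λ x → map′ (∈Up⇒Reached hit⇔V) (Reached⇒∈Up hit⇔V) (dec x)) ⟩
      countReached G (λ x → toℕ x <ᵇ ∣ V ∣) (λ x → not (toℕ x <ᵇ ∣ V ∣)) ∎
    where
    open ≡-Reasoning
    hit⇔V : ∀ y → T (toℕ y <ᵇ ∣ V ∣) ⇔ y ∈ V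
    hit⇔V y = mk⇔ (Equivalence.from (∈V⇔<∣V∣ y) ∘ ℕₚ.<ᵇ⇒< _ _) (ℕₚ.<⇒<ᵇ ∘ Equivalence.to (∈V⇔<∣V∣ y))

lemma5p2 : (c : ℚ) (n : ℕ) .{{_ : NonZero n}} →
    0ℚ < c → c ≤ℚ (+ n Data.Rational./ 1) →
    (U V : Subset n) →
    (∀ x → x ∈ U ⊎ x ∈ V) → (∀ x → ¬ (x ∈ U × x ∈ V)) →
    (∀ x y → x ∈ V → y ∈ U → toℕ x ℕ.< toℕ y) →
    (dec : (G : Graph n) (x : Fin n) → Dec (x ∈Up[ G , V ])) →
    (s : ℕ) → 1 ≤ s →
    ℙ n (pOf c n) (λ G → ⌊ countUpIn G V U (dec G) ℕ.≟ s ⌋)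
      ≡ (qOf c n ^ℤ (+ ∣ V ∣ ℤ.* (+ ∣ U ∣ ℤ.- + s)))
        * prodFrom 0 s (λ j → 1ℚ - qOf c n ^ (j ℕ.+ ∣ V ∣))
        * prodFrom 1 s (λ i → (1ℚ - qOf c n ^ℤ (+ ∣ U ∣ ℤ.- + s ℤ.+ + i)) ⊘ (1ℚ - qOf c n ^ i))
lemma5p2 c n 0<c c≤n U V cover disjoint V<U dec s _ = begin
    ℙ n p (λ G → ⌊ countUpIn G V U (dec G) ℕ.≟ s ⌋)
  ≡⟨ expectOver-cong p (pairs n) (λ G → cong (exactly s) (count-via-sweep G)) ⟩
    𝔼reached p n (λ x → toℕ x <ᵇ v) (λ x → not (toℕ x <ᵇ v)) (exactly s)
  ≡⟨ 𝔼reached-cong p n _ (exactly s) (λ x → sym (∨-identityʳ _)) (λ _ → refl) ⟩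
    𝔼reached p n (prefixOr v [] ∘ toℕ) (λ x → not (toℕ x <ᵇ v)) (exactly s)
  ≡⟨ 𝔼reached-prefix p v n [] (exactly s) (∣p∣≤n V) ⟩
    𝔼bits (1ℚ - q ^ v) (n ∸ v) (λ z → 𝔼reached p (n ∸ v) (bit z ∘ toℕ) (λ _ → true) (exactly s))
  ≡⟨ 𝔼bits-𝔼reached≡reachedLaw p (n ∸ v) v s ⟩
    reachedLaw q (n ∸ v) v s
  ≡⟨ cong (λ m → reachedLaw q m v s) (sym (∣U∣≡n∸∣V∣ U V cover disjoint V<U)) ⟩
    reachedLaw q ∣ U ∣ v s
  ≡⟨ sym (closedForm≡reachedLaw (0≤qOf c n 0<c c≤n) (qOf<1 c n 0<c c≤n) ∣ U ∣ v s) ⟩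
    _ ∎
  where
  open ≡-Reasoning
  p = pOf c n
  q = qOf c n
  v = ∣ V ∣
  count-via-sweep : ∀ G → countUpIn G V U (dec G) ≡ countReached G (λ x → toℕ x <ᵇ v) (λ x → not (toℕ x <ᵇ v))
  count-via-sweep G = countUpIn≡countReached U V cover disjoint V<U G (dec G)
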